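{- Let $X$ be a finite graph and let $v$ be a vertex of $X$ such that the class $[v]=\{w\in V(X): \langle N(w,X)\rangle\cong\langle N(v,X)\rangle\}$ has odd cardinality. If $\langle N(v,X)\rangle$ does not have an automorphism that is a product of transpositions, then $X$ is not the induced neighbourhood of a finite Cayley graph, i.e. there is no finite Cayley graph $Y$ with $\langle N(y,Y)\rangle\cong X$ for all vertices $y$ of $Y$.
   Context: All graphs are simple. For a vertex $v$ of a graph $X$, $N(v,X)$ is the set of neighbours of $v$ and $\langle N(v,X)\rangle$ is the subgraph induced on it. The equivalence relation $\sim$ on $V(X)$ is given by $u\sim w$ iff $\langle N(u,X)\rangle\cong\langle N(w,X)\rangle$, with class $[v]$ of $v$. An automorphism of a graph is called a product of transpositions if, as a permutation of the vertex set, it is a product of disjoint transpositions moving every vertex (i.e. a fixed-point-free involution; for the graph with no vertices, the identity). -}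

module Defs where

open import Data.Nat using (ℕ; suc; _+_; _*_)
open import Data.Bool using (Bool; true; false)
open import Data.Fin using (Fin)
open import Data.Product using (Σ; _×_; proj₁; ∃)
open import Relation.Binary.PropositionalEquality using (_≡_; _≢_)
open import Function.Bundles using (_↔_; Inverse)
open import Algebra.Structures using (IsGroup)

record Graph : Set₁ where
  field
    V : Set
    E : V → V → Bool
open Graph public

IsSimple : Graph → Set
IsSimple G = (∀ u w → E G u w ≡ E G w u) × (∀ u → E G u u ≡ false)

FinGraph : (n : ℕ) → (Fin n → Fin n → Bool) → Graph
FinGraph n e = record { V = Fin n ; E = e }

Nbhd : (G : Graph) → V G → Graph
Nbhd G v = record
  { V = Σ (V G) (λ w → E G v w ≡ true)
  ; E = λ a b → E G (proj₁ a) (proj₁ b) }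

_≅_ : Graph → Graph → Set
G ≅ H = Σ (V G ↔ V H) λ f →
  ∀ u w → E H (Inverse.to f u) (Inverse.to f w) ≡ E G u w

-- G has an automorphism that is a product of (disjoint) transpositions moving
-- every vertex, i.e. a fixed-point-free involutive automorphism.
HasFPFInvolutiveAut : Graph → Set
HasFPFInvolutiveAut G = Σ (G ≅ G) λ σ →
  ∀ x → (Inverse.to (proj₁ σ) (Inverse.to (proj₁ σ) x) ≡ x)
      × (Inverse.to (proj₁ σ) x ≢ x)

record FiniteCayleyData : Set₁ where
  field
    C       : Set
    _∙_     : C → C → C
    ε       : C
    _⁻¹     : C → C
    isGroup : IsGroup _≡_ _∙_ ε _⁻¹
    order   : ℕ
    finite  : C ↔ Fin order
    S       : C → Bool
    S-inv   : ∀ x → S (x ⁻¹) ≡ S x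
    S-ε     : S ε ≡ false

Cay : FiniteCayleyData → Graph
Cay Γ = record { V = C ; E = λ g h → S ((g ⁻¹) ∙ h) }
  where open FiniteCayleyData Γ

IsNbhdOfFiniteCayley : Graph → Set₁
IsNbhdOfFiniteCayley X = Σ FiniteCayleyData λ Γ → ∀ y → Nbhd (Cay Γ) y ≅ X

Odd : ℕ → Set
Odd m = ∃ λ k → m ≡ suc (2 * k)

{-# OPTIONS --safe #-}
-- Suppose ⟨N(y, Cay(Γ,S))⟩ ≅ X for all y, so in particular X ≅ ⟨S⟩ = N(1).
-- Left multiplication by s⁻¹ is an automorphism of the Cayley graph sending
-- s to 1 and 1 to s⁻¹, so it maps the common neighbourhood of 1 and s, which
-- is ⟨N(s, ⟨S⟩)⟩, onto that of 1 and s⁻¹. Hence inversion is an involution of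
-- ⟨S⟩ ≅ X preserving neighbourhood types, and so it permutes the class [v].
-- As [v] has odd size, the involution fixes some w ∈ [v]: w corresponds to
-- some s = s⁻¹, and then left multiplication by s is a fixed-point-free
-- involutive automorphism of ⟨N(s, ⟨S⟩)⟩ ≅ ⟨N(w, X)⟩ ≅ ⟨N(v, X)⟩.
module Submission where

open import Defs
open import Data.Nat using (ℕ)
open import Data.Bool using (Bool)
open import Data.Fin using (Fin)
open import Data.Fin.Subset using (Subset; _∈_; ∣_∣)
open import Relation.Nullary using (¬_)

open import Axiom.UniquenessOfIdentityProofs using (module Decidable⇒UIP)
open import Algebra.Bundles using (Group)
import Algebra.Properties.Group as GroupProperties
import Algebra.Properties.Loop as LoopProperties
open import Data.Bool using (true) renaming (_≟_ to _≟ᵇ_)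
open import Data.Fin using (zero; suc; _≟_)
open import Data.Fin.Subset using (Nonempty; _⊆_; _-_; _─_; ⁅_⁆; inside; outside; _∉_)
open import Data.Fin.Subset.Properties
  using (p─⊥≡p; p─q⊆p; x∈p∧x≢y⇒x∈p-y; x∉⁅y⁆⇒x≢y)
open import Data.Nat using (zero; suc; _+_; _*_)
open import Data.Nat.Properties using (*-suc; suc-injective; 1+n≢0)
open import Data.Product using (Σ; ∃-syntax; _×_; _,_; proj₁; proj₂)
import Data.Product as Product
open import Data.Sum using (_⊎_; inj₁; inj₂)
open import Data.Vec using (_∷_; []; here; there)
open import Function.Base using (_∘_)
open import Function.Bundles using (_↔_; Inverse; mk↔ₛ′)
open import Function.Properties.Inverse using (↔-sym; ↔-trans)
open import Relation.Binary.PropositionalEquality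
open import Relation.Nullary using (yes; no; contradiction)

-- The same data as Defs' _≅_, but as a record, so that Agda can infer both
-- graphs from an isomorphism.
record _≃_ (G H : Graph) : Set where
  field
    bijection : V G ↔ V H
  open Inverse bijection public using (to; from; strictlyInverseˡ; strictlyInverseʳ)
  field
    adjacency : ∀ u w → E H (to u) (to w) ≡ E G u w
open _≃_ public

≅⇒≃ : {G H : Graph} → G ≅ H → G ≃ H
≅⇒≃ (f , adj) = record { bijection = f ; adjacency = adj }

≃⇒≅ : {G H : Graph} → G ≃ H → G ≅ H
≃⇒≅ φ = bijection φ , adjacency φ

≃-sym : {G H : Graph} → G ≃ H → H ≃ G
≃-sym {G} {H} φ = record
  { bijection = ↔-sym (bijection φ)
  ; adjacency = λ u w → begin
      E G (from φ u) (from φ w)                       ≡⟨ adjacency φ (from φ u) (from φ w) ⟨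
      E H (to φ (from φ u)) (to φ (from φ w))         ≡⟨ cong₂ (E H) (strictlyInverseˡ φ u) (strictlyInverseˡ φ w) ⟩
      E H u w                                         ∎
  }
  where open ≡-Reasoning

≃-trans : {G H K : Graph} → G ≃ H → H ≃ K → G ≃ K
≃-trans φ ψ = record
  { bijection = ↔-trans (bijection φ) (bijection ψ)
  ; adjacency = λ u w → trans (adjacency ψ (to φ u) (to φ w)) (adjacency φ u w)
  }

Induced : (G : Graph) → (V G → Bool) → Graph
Induced G P = record { V = Σ (V G) (λ x → P x ≡ true) ; E = λ a b → E G (proj₁ a) (proj₁ b) }

-- Nbhd G u is definitionally Induced G (E G u), and Nbhd (Nbhd G u) (w , p) is
-- definitionally CommonNbhd G u w, whatever the proof p.
CommonNbhd : (G : Graph) → V G → V G → Graph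
CommonNbhd G u w = Induced (Induced G (E G u)) (λ b → E G w (proj₁ b))

subtype-≡ : {A : Set} {P : A → Bool} {a b : Σ A (λ x → P x ≡ true)} → proj₁ a ≡ proj₁ b → a ≡ b
subtype-≡ {a = x , p} {b = .x , q} refl = cong (x ,_) (Decidable⇒UIP.≡-irrelevant _≟ᵇ_ p q)

induced-≃ : {G H : Graph} {P : V G → Bool} {Q : V H → Bool} (φ : G ≃ H) →
            (∀ x → Q (to φ x) ≡ P x) → Induced G P ≃ Induced H Q
induced-≃ {G} {H} {P} {Q} φ Q∘to≡P = record
  { bijection = mk↔ₛ′ restrict-to restrict-from
      (λ b → subtype-≡ (strictlyInverseˡ φ (proj₁ b)))
      (λ a → subtype-≡ (strictlyInverseʳ φ (proj₁ a)))
  ; adjacency = λ a b → adjacency φ (proj₁ a) (proj₁ b)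
  }
  where
  restrict-to : V (Induced G P) → V (Induced H Q)
  restrict-to (x , Px) = to φ x , trans (Q∘to≡P x) Px
  restrict-from : V (Induced H Q) → V (Induced G P)
  restrict-from (y , Qy) = from φ y ,
    trans (sym (Q∘to≡P (from φ y))) (trans (cong Q (strictlyInverseˡ φ y)) Qy)

nbhd-≃ : {G H : Graph} (φ : G ≃ H) (u : V G) → Nbhd G u ≃ Nbhd H (to φ u)
nbhd-≃ φ u = induced-≃ φ (adjacency φ u)

adjacency-at : {G H : Graph} (φ : G ≃ H) {u : V G} {u′ : V H} → to φ u ≡ u′ →
               ∀ x → E H u′ (to φ x) ≡ E G u x
adjacency-at φ {u} refl = adjacency φ u

commonNbhd-≃ : {G H : Graph} (φ : G ≃ H) {u w : V G} {u′ w′ : V H} →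
               to φ u ≡ u′ → to φ w ≡ w′ → CommonNbhd G u w ≃ CommonNbhd H u′ w′
commonNbhd-≃ φ u↦u′ w↦w′ =
  induced-≃ (induced-≃ φ (adjacency-at φ u↦u′)) (λ b → adjacency-at φ w↦w′ (proj₁ b))

commonNbhd-swap : {G : Graph} {u w : V G} → CommonNbhd G u w ≃ CommonNbhd G w u
commonNbhd-swap = record
  { bijection = mk↔ₛ′ swap swap (λ _ → refl) (λ _ → refl)
  ; adjacency = λ _ _ → refl
  }
  where
  swap : ∀ {A : Set} {P Q : A → Bool} →
         Σ (Σ A (λ x → P x ≡ true)) (λ b → Q (proj₁ b) ≡ true) →
         Σ (Σ A (λ x → Q x ≡ true)) (λ b → P (proj₁ b) ≡ true)
  swap ((x , Px) , Qx) = (x , Qx) , Px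

hasFPFInvolutiveAut-resp-≃ : {G H : Graph} → G ≃ H → HasFPFInvolutiveAut G → HasFPFInvolutiveAut H
hasFPFInvolutiveAut-resp-≃ {G} {H} φ (σ , σ-fpf-involution) =
  ≃⇒≅ conjugate , λ y → involutive y , fixed-point-free y
  where
  open ≡-Reasoning
  σ′ : G ≃ G
  σ′ = ≅⇒≃ σ
  conjugate : H ≃ H
  conjugate = ≃-trans (≃-sym φ) (≃-trans σ′ φ)
  involutive : ∀ y → to conjugate (to conjugate y) ≡ y
  involutive y = begin
    to φ (to σ′ (from φ (to φ (to σ′ (from φ y)))))  ≡⟨ cong (to φ ∘ to σ′) (strictlyInverseʳ φ _) ⟩
    to φ (to σ′ (to σ′ (from φ y)))                   ≡⟨ cong (to φ) (proj₁ (σ-fpf-involution (from φ y))) ⟩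
    to φ (from φ y)                                   ≡⟨ strictlyInverseˡ φ y ⟩
    y                                                 ∎
  fixed-point-free : ∀ y → to conjugate y ≢ y
  fixed-point-free y fixed = proj₂ (σ-fpf-involution (from φ y)) (begin
    to σ′ (from φ y)                      ≡⟨ strictlyInverseʳ φ _ ⟨
    from φ (to φ (to σ′ (from φ y)))      ≡⟨ cong (from φ) fixed ⟩
    from φ y                              ∎)

∣p∣≢0⇒Nonempty : ∀ {n} {p : Subset n} → ∣ p ∣ ≢ 0 → Nonempty p
∣p∣≢0⇒Nonempty {p = []}          ∣p∣≢0 = contradiction refl ∣p∣≢0
∣p∣≢0⇒Nonempty {p = inside  ∷ p} ∣p∣≢0 = zero , here
∣p∣≢0⇒Nonempty {p = outside ∷ p} ∣p∣≢0 = Product.map suc there (∣p∣≢0⇒Nonempty ∣p∣≢0)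

x∈p⇒∣p∣≡1+∣p-x∣ : ∀ {n} {p : Subset n} {x : Fin n} → x ∈ p → ∣ p ∣ ≡ suc ∣ p - x ∣
x∈p⇒∣p∣≡1+∣p-x∣ {p = inside  ∷ p} {zero}  here      = cong (suc ∘ ∣_∣) (sym (p─⊥≡p p))
x∈p⇒∣p∣≡1+∣p-x∣ {p = inside  ∷ p} {suc x} (there x∈p) = cong suc (x∈p⇒∣p∣≡1+∣p-x∣ x∈p)
x∈p⇒∣p∣≡1+∣p-x∣ {p = outside ∷ p} {suc x} (there x∈p) = x∈p⇒∣p∣≡1+∣p-x∣ x∈p

x∈p─q⇒x∉q : ∀ {n} {p q : Subset n} {x : Fin n} → x ∈ p ─ q → x ∉ q
x∈p─q⇒x∉q {p = inside ∷ p} {outside ∷ q} here ()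
x∈p─q⇒x∉q {p = _ ∷ p} {_ ∷ q} (there x∈p─q) (there x∈q) = x∈p─q⇒x∉q x∈p─q x∈q

x∈p-y⇒x≢y : ∀ {n} {p : Subset n} {x y : Fin n} → x ∈ p - y → x ≢ y
x∈p-y⇒x≢y = x∉⁅y⁆⇒x≢y ∘ x∈p─q⇒x∉q

module _ {n : ℕ} (τ : Fin n → Fin n) (τ-involutive : ∀ x → τ (τ x) ≡ x) where

  Invariant : Subset n → Set
  Invariant p = ∀ {x} → x ∈ p → τ x ∈ p

  fixed-point-or-orbit-removable : {p : Subset n} → Invariant p → Nonempty p →
    (∃[ x ] x ∈ p × τ x ≡ x) ⊎ (∃[ q ] q ⊆ p × Invariant q × ∣ p ∣ ≡ 2 + ∣ q ∣)
  fixed-point-or-orbit-removable {p} invariant (x , x∈p) with τ x ≟ x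
  ... | yes fixed = inj₁ (x , x∈p , fixed)
  ... | no moved  = inj₂ (p - x - τ x , ⊆p , invariant′ , size)
    where
    ⊆p : p - x - τ x ⊆ p
    ⊆p = p─q⊆p p ⁅ x ⁆ ∘ p─q⊆p (p - x) ⁅ τ x ⁆
    τx∈p-x : τ x ∈ p - x
    τx∈p-x = x∈p∧x≢y⇒x∈p-y (invariant x∈p) moved
    size : ∣ p ∣ ≡ 2 + ∣ p - x - τ x ∣
    size = trans (x∈p⇒∣p∣≡1+∣p-x∣ x∈p) (cong suc (x∈p⇒∣p∣≡1+∣p-x∣ τx∈p-x))
    invariant′ : Invariant (p - x - τ x)
    invariant′ {y} y∈q = x∈p∧x≢y⇒x∈p-y (x∈p∧x≢y⇒x∈p-y (invariant (⊆p y∈q)) τy≢x) τy≢τx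
      where
      τy≢x : τ y ≢ x
      τy≢x τy≡x = x∈p-y⇒x≢y y∈q (trans (sym (τ-involutive y)) (cong τ τy≡x))
      τy≢τx : τ y ≢ τ x
      τy≢τx τy≡τx = x∈p-y⇒x≢y (p─q⊆p (p - x) ⁅ τ x ⁆ y∈q)
        (trans (sym (τ-involutive y)) (trans (cong τ τy≡τx) (τ-involutive x)))

  odd-invariant⇒fixed-point : ∀ k {p : Subset n} → Invariant p → ∣ p ∣ ≡ suc (2 * k) →
                              ∃[ x ] x ∈ p × τ x ≡ x
  odd-invariant⇒fixed-point k invariant size
    with fixed-point-or-orbit-removable invariant (∣p∣≢0⇒Nonempty (1+n≢0 ∘ trans (sym size)))
  ... | inj₁ fixed = fixed
  ... | inj₂ (q , q⊆p , invariant′ , size′) with k | trans (sym size′) size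
  ...   | zero  | ()
  ...   | suc k | 2+∣q∣≡1+2[1+k] = Product.map₂ (Product.map₁ q⊆p)
          (odd-invariant⇒fixed-point k invariant′
            (suc-injective (suc-injective (trans 2+∣q∣≡1+2[1+k] (cong suc (*-suc 2 k))))))

module CayleyGraph (Γ : FiniteCayleyData) where
  open FiniteCayleyData Γ using (C; ε; isGroup; S; S-inv; S-ε)

  group : Group _ _
  group = record
    { Carrier = C ; _≈_ = _≡_ ; _∙_ = FiniteCayleyData._∙_ Γ ; ε = ε
    ; _⁻¹ = FiniteCayleyData._⁻¹ Γ ; isGroup = isGroup }

  open Group group using (_∙_; _⁻¹; assoc; identityˡ; identityʳ; inverseˡ)
  open GroupProperties group using (loop; ⁻¹-involutive; ⁻¹-anti-homo-∙; \\-leftDividesˡ; \\-leftDividesʳ)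
  open LoopProperties loop using (ε\\x≈x; identityˡ-unique)

  translation : C → Cay Γ ≃ Cay Γ
  translation g = record
    { bijection = mk↔ₛ′ (g ∙_) ((g ⁻¹) ∙_) (\\-leftDividesˡ g) (\\-leftDividesʳ g)
    ; adjacency = λ x y → cong S (begin
        (g ∙ x) ⁻¹ ∙ (g ∙ y)       ≡⟨ cong (_∙ (g ∙ y)) (⁻¹-anti-homo-∙ g x) ⟩
        (x ⁻¹ ∙ g ⁻¹) ∙ (g ∙ y)    ≡⟨ assoc (x ⁻¹) (g ⁻¹) (g ∙ y) ⟩
        x ⁻¹ ∙ (g ⁻¹ ∙ (g ∙ y))    ≡⟨ cong (x ⁻¹ ∙_) (\\-leftDividesʳ g y) ⟩
        x ⁻¹ ∙ y                   ∎)
    }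
    where open ≡-Reasoning

  Nε : Graph
  Nε = Nbhd (Cay Γ) ε

  commonNbhd-translation-≃ : ∀ {s t} → t ∙ s ≡ ε → CommonNbhd (Cay Γ) ε s ≃ CommonNbhd (Cay Γ) ε t
  commonNbhd-translation-≃ {s} {t} ts≡ε =
    ≃-trans (commonNbhd-swap {Cay Γ} {ε} {s}) (commonNbhd-≃ (translation t) ts≡ε (identityʳ t))

  inversion : V Nε → V Nε
  inversion (s , ps) = s ⁻¹ , (begin
    S (ε ⁻¹ ∙ s ⁻¹)  ≡⟨ cong S (ε\\x≈x (s ⁻¹)) ⟩
    S (s ⁻¹)         ≡⟨ S-inv s ⟩
    S s              ≡⟨ cong S (ε\\x≈x s) ⟨
    S (ε ⁻¹ ∙ s)     ≡⟨ ps ⟩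
    true             ∎)
    where open ≡-Reasoning

  inversion-involutive : ∀ a → inversion (inversion a) ≡ a
  inversion-involutive (s , _) = subtype-≡ (⁻¹-involutive s)

  nbhd-inversion-≃ : ∀ a → Nbhd Nε a ≃ Nbhd Nε (inversion a)
  nbhd-inversion-≃ (s , _) = commonNbhd-translation-≃ (inverseˡ s)

  inversion-fixed⇒fpf : ∀ a → inversion a ≡ a → HasFPFInvolutiveAut (Nbhd Nε a)
  inversion-fixed⇒fpf (s , ps) fixed = ≃⇒≅ σ , λ x → involutive x , moves x
    where
    open ≡-Reasoning
    s∙s≡ε : s ∙ s ≡ ε
    s∙s≡ε = trans (cong (_∙ s) (sym (cong proj₁ fixed))) (inverseˡ s)
    σ : Nbhd Nε (s , ps) ≃ Nbhd Nε (s , ps)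
    σ = commonNbhd-translation-≃ s∙s≡ε
    involutive : ∀ x → to σ (to σ x) ≡ x
    involutive ((x , _) , _) = subtype-≡ (subtype-≡ (begin
      s ∙ (s ∙ x)  ≡⟨ assoc s s x ⟨
      (s ∙ s) ∙ x  ≡⟨ cong (_∙ x) s∙s≡ε ⟩
      ε ∙ x        ≡⟨ identityˡ x ⟩
      x            ∎))
    s≢ε : s ≢ ε
    s≢ε refl with () ← trans (sym ps) (trans (cong S (ε\\x≈x ε)) S-ε)
    moves : ∀ x → to σ x ≢ x
    moves ((x , _) , _) σx≡x = s≢ε (identityˡ-unique s x (cong (proj₁ ∘ proj₁) σx≡x))

  module InversionOn {X : Graph} (ψ : X ≃ Nε) where

    τ : V X → V X
    τ = from ψ ∘ inversion ∘ to ψ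

    τ-involutive : ∀ x → τ (τ x) ≡ x
    τ-involutive x = begin
      from ψ (inversion (to ψ (from ψ (inversion (to ψ x)))))  ≡⟨ cong (from ψ ∘ inversion) (strictlyInverseˡ ψ _) ⟩
      from ψ (inversion (inversion (to ψ x)))                   ≡⟨ cong (from ψ) (inversion-involutive _) ⟩
      from ψ (to ψ x)                                           ≡⟨ strictlyInverseʳ ψ x ⟩
      x                                                         ∎
      where open ≡-Reasoning

    nbhd-τ-≃ : ∀ x → Nbhd X (τ x) ≃ Nbhd X x
    nbhd-τ-≃ x =
      ≃-trans (≃-sym (nbhd-≃ (≃-sym ψ) (inversion (to ψ x))))
        (≃-trans (≃-sym (nbhd-inversion-≃ (to ψ x))) (≃-sym (nbhd-≃ ψ x)))

    τ-fixed⇒fpf : ∀ {x} → τ x ≡ x → HasFPFInvolutiveAut (Nbhd X x)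
    τ-fixed⇒fpf {x} fixed =
      hasFPFInvolutiveAut-resp-≃ (≃-sym (nbhd-≃ ψ x)) (inversion-fixed⇒fpf (to ψ x) (begin
        inversion (to ψ x)  ≡⟨ strictlyInverseˡ ψ _ ⟨
        to ψ (τ x)          ≡⟨ cong (to ψ) fixed ⟩
        to ψ x              ∎))
      where open ≡-Reasoning

lemma2p2 : (n : ℕ) (e : Fin n → Fin n → Bool) → IsSimple (FinGraph n e) →
    (v : Fin n) (cls : Subset n) →
    (∀ w → w ∈ cls → Nbhd (FinGraph n e) w ≅ Nbhd (FinGraph n e) v) →
    (∀ w → Nbhd (FinGraph n e) w ≅ Nbhd (FinGraph n e) v → w ∈ cls) →
    Odd ∣ cls ∣ →
    ¬ HasFPFInvolutiveAut (Nbhd (FinGraph n e) v) →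
    ¬ IsNbhdOfFiniteCayley (FinGraph n e)
lemma2p2 n e _ v cls cls⊆[v] [v]⊆cls (k , ∣cls∣≡1+2k) no-fpf (Γ , nbhd≅X) =
  let w , w∈cls , τw≡w = odd-invariant⇒fixed-point τ τ-involutive k τ-invariant ∣cls∣≡1+2k
  in no-fpf (hasFPFInvolutiveAut-resp-≃ (cls-≃ w∈cls) (τ-fixed⇒fpf τw≡w))
  where
  X : Graph
  X = FinGraph n e
  open CayleyGraph Γ
  open InversionOn {X} (≃-sym (≅⇒≃ (nbhd≅X (FiniteCayleyData.ε Γ))))
  cls-≃ : ∀ {w} → w ∈ cls → Nbhd X w ≃ Nbhd X v
  cls-≃ w∈cls = ≅⇒≃ (cls⊆[v] _ w∈cls)
  τ-invariant : ∀ {w} → w ∈ cls → τ w ∈ cls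
  τ-invariant {w} w∈cls = [v]⊆cls (τ w) (≃⇒≅ (≃-trans (nbhd-τ-≃ w) (cls-≃ w∈cls)))
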